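{- Let $s,s'$ be two scenarios with $w_v(s')\le w_v(s)$ for all $v\in V$. Then (1) for every vertex set $V'\subseteq V$ inducing a subtree of $T$ and every $x\in V'$, $\Theta(V',x:s')\le\Theta(V',x:s)$; (2) $\Theta_{\rm OPT}(s')\le\Theta_{\rm OPT}(s)$.
   Context: $T=(V,E)$ is a tree with positive edge lengths; $d(u,v)$ is the length of the path between $u$ and $v$; $c>0$ is a uniform capacity; $k\ge1$ is a fixed integer. A scenario $s$ assigns a weight $w_v(s)\ge 0$ to each $v\in V$. For a vertex set $V_\ell$ inducing a subtree and a vertex $x\notin V_\ell$ adjacent to a vertex of $V_\ell$: $D(V_\ell,x,v')=\{v\in V_\ell: d(v,x)\ge d(v',x)\}$, $W(V_\ell,x,v':s)=\sum_{v\in D(V_\ell,x,v')}w_v(s)$, and $\Theta(V_\ell\cup\{x\},x:s)=\max_{v'\in V_\ell:W(V_\ell,x,v':s)>0}\bigl(d(v',x)+W(V_\ell,x,v':s)/c\bigr)$ ($0$ if no such $v'$). For $V'$ inducing a subtree and $x\in V'$ with branches $V_1,\dots,V_t$ (vertex sets of the components of the induced subtree minus $x$), $\Theta(V',x:s)=\max_\ell\Theta(V_\ell\cup\{x\},x:s)$, and $\Theta(\{x\},x:s)=0$. A $k$-partition of $V$ is a partition into $k$ nonempty sets each inducing a subtree; for $X=\{x_1,\dots,x_k\}\subseteq V$, $\Lambda[X]$ is the set of $k$-partitions $\{P_1,\dots,P_k\}$ with $X\cap P_i=\{x_i\}$. $\Theta(\mathcal{P},X:s)=\max_i\Theta(P_i,x_i:s)$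 and $\Theta_{\rm OPT}(s)=\min\{\Theta(\mathcal{P},X:s):|X|=k,\ \mathcal{P}\in\Lambda[X]\}$.
   Formalization: The edge lengths of T, the capacity c and the scenario weights $w_v(s)$ are rational numbers. -}

module Defs where

open import Data.Nat using (ℕ; zero; suc)
open import Data.Fin using (Fin; zero; suc)
open import Data.Fin.Properties using () renaming (_≟_ to _≟F_)
open import Data.Bool using (Bool; true; false; _∧_; _∨_; not; if_then_else_)
open import Data.List using (List; []; _∷_; foldr; map; mapMaybe; allFin)
open import Data.Bool.ListAction using (any)
open import Data.Maybe using (Maybe; just; nothing; fromMaybe)
open import Data.Rational using (ℚ; 0ℚ; _+_; _÷_; _⊔_; _≤_; _<_; >-nonZero)
open import Data.Rational.Properties using (_≤?_; _<?_)
open import Data.Product using (Σ; _×_; ∃)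
open import Function.Definitions using (Injective)
open import Relation.Nullary.Decidable using (⌊_⌋)
open import Relation.Binary.PropositionalEquality using (_≡_)

-- Every finite tree (with n ≥ 1 vertices) arises, up to relabelling, by
-- repeatedly attaching a new leaf: the new vertex is 'zero', old vertex i
-- becomes 'suc i', and the new leaf is joined to (the old vertex) p by an
-- edge of positive length ℓ.
data Tree : ℕ → Set where
  single : Tree 1
  attach : ∀ {n} → Tree n → (p : Fin n) → (ℓ : ℚ) → 0ℚ < ℓ → Tree (suc n)

adj : ∀ {n} → Tree n → Fin n → Fin n → Bool
adj single _ _ = false
adj (attach t p ℓ _) zero zero = false
adj (attach t p ℓ _) zero (suc j) = ⌊ p ≟F j ⌋
adj (attach t p ℓ _) (suc i) zero = ⌊ i ≟F p ⌋
adj (attach t p ℓ _) (suc i) (suc j) = adj t i j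

dist : ∀ {n} → Tree n → Fin n → Fin n → ℚ
dist single _ _ = 0ℚ
dist (attach t p ℓ _) zero zero = 0ℚ
dist (attach t p ℓ _) zero (suc j) = ℓ + dist t p j
dist (attach t p ℓ _) (suc i) zero = dist t i p + ℓ
dist (attach t p ℓ _) (suc i) (suc j) = dist t i j

VSet : ℕ → Set
VSet n = Fin n → Bool

reachVec : ∀ {n} → Tree n → VSet n → Fin n → ℕ → VSet n
reachVec t S u zero v = S u ∧ ⌊ u ≟F v ⌋
reachVec {n} t S u (suc k) v =
  R v ∨ (S v ∧ any (λ w → R w ∧ adj t w v) (allFin n))
  where
  R = reachVec t S u k

-- u and v are connected in the subgraph of T induced by S
-- (a path in a graph on n vertices has at most n edges).
connectedIn : ∀ {n} → Tree n → VSet n → Fin n → Fin n → Bool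
connectedIn {n} t S u v = reachVec t S u n v

InducesSubtree : ∀ {n} → Tree n → VSet n → Set
InducesSubtree {n} t S =
  (∃ λ v → S v ≡ true) ×
  (∀ u v → S u ≡ true → S v ≡ true → connectedIn t S u v ≡ true)

Scenario : ℕ → Set
Scenario n = Fin n → ℚ

IsScenario : ∀ {n} → Scenario n → Set
IsScenario w = ∀ v → 0ℚ ≤ w v

sumℚ : List ℚ → ℚ
sumℚ = foldr _+_ 0ℚ

maxList : List ℚ → Maybe ℚ
maxList [] = nothing
maxList (a ∷ as) with maxList as
... | nothing = just a
... | just m = just (a ⊔ m)

Dset : ∀ {n} → Tree n → VSet n → Fin n → Fin n → VSet n
Dset t Vl x v' v = Vl v ∧ ⌊ dist t v' x ≤? dist t v x ⌋

Wgt : ∀ {n} → Tree n → Scenario n → VSet n → Fin n → Fin n → ℚ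
Wgt {n} t s Vl x v' =
  sumℚ (map (λ v → if Dset t Vl x v' v then s v else 0ℚ) (allFin n))

-- Θ(V_ℓ ∪ {x}, x : s) for a branch V_ℓ (x ∉ V_ℓ, x adjacent to V_ℓ)
ΘBranch : ∀ {n} → Tree n → (c : ℚ) → 0ℚ < c → Scenario n → VSet n → Fin n → ℚ
ΘBranch {n} t c cpos s Vl x =
  fromMaybe 0ℚ (maxList (mapMaybe cand (allFin n)))
  where
  cand : Fin n → Maybe ℚ
  cand v' with Vl v' ∧ ⌊ 0ℚ <? Wgt t s Vl x v' ⌋
  ... | true = just (dist t v' x + _÷_ (Wgt t s Vl x v') c {{>-nonZero cpos}})
  ... | false = nothing

minus : ∀ {n} → VSet n → Fin n → VSet n
minus S x v = S v ∧ not ⌊ v ≟F x ⌋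

branch : ∀ {n} → Tree n → VSet n → Fin n → Fin n → VSet n
branch t S x v' v = connectedIn t (minus S x) v' v

-- Θ(V', x : s) = max over the branches V_ℓ of Θ(V_ℓ ∪ {x}, x : s), 0 if none.
-- Branches are listed via their members v' ∈ V' \ {x} (repetitions do not
-- change the maximum).
Θ : ∀ {n} → Tree n → (c : ℚ) → 0ℚ < c → Scenario n → VSet n → Fin n → ℚ
Θ {n} t c cpos s S x =
  fromMaybe 0ℚ (maxList (mapMaybe br (allFin n)))
  where
  br : Fin n → Maybe ℚ
  br v' with minus S x v'
  ... | true = just (ΘBranch t c cpos s (branch t S x v') x)
  ... | false = nothing

-- A k-partition with centres: X : Fin k → Fin n (injective, so |X| = k),
-- part : Fin n → Fin k assigns each vertex to its part P_i = part⁻¹(i).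
Part : ∀ {n k} → (Fin n → Fin k) → Fin k → VSet n
Part part i v = ⌊ part v ≟F i ⌋

-- X ⊆ V with |X| = k and 𝒫 ∈ Λ[X]: each P_i induces a subtree and
-- X ∩ P_i = {x_i} (i.e. part (X j) ≡ j for all j).
Feasible : ∀ {n k} → Tree n → (Fin k → Fin n) → (Fin n → Fin k) → Set
Feasible {n} {k} t X part =
  Injective _≡_ _≡_ X ×
  (∀ i → part (X i) ≡ i) ×
  (∀ i → InducesSubtree t (Part part i))

ΘPart : ∀ {n k} → Tree n → (c : ℚ) → 0ℚ < c → Scenario n →
        (Fin k → Fin n) → (Fin n → Fin k) → ℚ
ΘPart {n} {k} t c cpos s X part =
  fromMaybe 0ℚ (maxList (map (λ i → Θ t c cpos s (Part part i) (X i)) (allFin k)))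

IsΘOPT : ∀ {n} → Tree n → (c : ℚ) → 0ℚ < c → (k : ℕ) → Scenario n → ℚ → Set
IsΘOPT {n} t c cpos k s θ =
  (Σ (Fin k → Fin n) λ X → Σ (Fin n → Fin k) λ part →
     Feasible t X part × ΘPart t c cpos s X part ≡ θ) ×
  (∀ (X : Fin k → Fin n) (part : Fin n → Fin k) →
     Feasible t X part → θ ≤ ΘPart t c cpos s X part)

{-# OPTIONS --safe #-}
-- Θ is built from the weights by sums, maxima with default 0, and adding or dividing by
-- positive constants, all monotone. The one subtlety is that v′ contributes a candidate only
-- when W(…:s′) > 0; then also W(…:s) > 0, so every candidate under s′ is dominated by one under
-- s, and as all candidates are nonnegative the default 0 does no harm. For Θ_OPT, an optimal
-- (X, 𝒫) for s gives Θ_OPT(s′) ≤ Θ(𝒫, X : s′) ≤ Θ(𝒫, X : s) = Θ_OPT(s).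
module Submission where

open import Defs
open import Data.Nat using (ℕ; _≥_)
open import Data.Fin using (Fin; zero; suc)
open import Data.Bool using (Bool; true; false; if_then_else_)
open import Data.Rational
  using (ℚ; 0ℚ; _≤_; _<_; _÷_; 1/_; NonZero; NonNegative; Positive; positive; nonNegative)
open import Data.Rational.Properties
open import Data.Product using (_×_; _,_)
open import Data.List using (List; []; _∷_; map; mapMaybe; allFin)
open import Data.List.Relation.Unary.All as All using (All; []; _∷_)
open import Data.List.Relation.Unary.All.Properties as All using ()
open import Data.List.Relation.Unary.Any as Any using (Any; here; there)
open import Data.List.Relation.Unary.Any.Properties as Any using ()
open import Data.List.Membership.Propositional using (_∈_)
open import Data.Maybe using (Maybe; just; nothing; fromMaybe)
open import Data.Maybe.Relation.Unary.All as MaybeAll using (just; nothing)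
open import Data.Maybe.Relation.Unary.Any as MaybeAny using (just)
open import Relation.Nullary.Decidable using (yes; no)
open import Relation.Nullary.Negation using (contradiction)
open import Relation.Binary.PropositionalEquality using (_≡_; refl)

max⁰ : List ℚ → ℚ
max⁰ xs = fromMaybe 0ℚ (maxList xs)

maxList-upper : ∀ {x xs} → Any (x ≤_) xs → MaybeAny.Any (x ≤_) (maxList xs)
maxList-upper {xs = a ∷ as} (here x≤a) with maxList as
... | nothing = just x≤a
... | just m  = just (≤-trans x≤a (p≤p⊔q a m))
maxList-upper {xs = a ∷ as} (there x≤as) with maxList as | maxList-upper x≤as
... | just m | just x≤m = just (≤-trans x≤m (p≤q⊔p a m))

max⁰-upper : ∀ {x xs} → Any (x ≤_) xs → x ≤ max⁰ xs
max⁰-upper {xs = xs} x≤xs with maxList xs | maxList-upper x≤xs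
... | just m | just x≤m = x≤m

max⁰-lub : ∀ {b xs} → 0ℚ ≤ b → All (_≤ b) xs → max⁰ xs ≤ b
max⁰-lub 0≤b [] = 0≤b
max⁰-lub {xs = x ∷ xs} 0≤b (x≤b ∷ xs≤b) with maxList xs | max⁰-lub 0≤b xs≤b
... | nothing | _   = x≤b
... | just m  | m≤b = ⊔-lub x≤b m≤b

max⁰-nonNeg : ∀ {xs} → All (0ℚ ≤_) xs → 0ℚ ≤ max⁰ xs
max⁰-nonNeg []               = ≤-refl
max⁰-nonNeg {xs} (0≤x ∷ _) = ≤-trans 0≤x (max⁰-upper {xs = xs} (here ≤-refl))

max⁰-mono : ∀ {xs ys} → All (0ℚ ≤_) ys → All (λ x → Any (x ≤_) ys) xs → max⁰ xs ≤ max⁰ ys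
max⁰-mono ys≥0 xs≼ys = max⁰-lub (max⁰-nonNeg ys≥0) (All.map max⁰-upper xs≼ys)

_≼_ : Maybe ℚ → Maybe ℚ → Set
m ≼ m′ = MaybeAll.All (λ a → MaybeAny.Any (a ≤_) m′) m

module _ {A : Set} (l : List A) {g : A → Maybe ℚ} (g≥0 : ∀ v → MaybeAll.All (0ℚ ≤_) (g v)) where
  private
    mapMaybe-nonNeg : All (0ℚ ≤_) (mapMaybe g l)
    mapMaybe-nonNeg = All.mapMaybe⁺ (All.map⁺ (All.universal g≥0 l))

  max⁰-mapMaybe-nonNeg : 0ℚ ≤ max⁰ (mapMaybe g l)
  max⁰-mapMaybe-nonNeg = max⁰-nonNeg mapMaybe-nonNeg

  max⁰-mapMaybe-mono : ∀ {f} → (∀ v → f v ≼ g v) → max⁰ (mapMaybe f l) ≤ max⁰ (mapMaybe g l)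
  max⁰-mapMaybe-mono {f} f≼g =
    max⁰-mono mapMaybe-nonNeg (All.mapMaybe⁺ (All.map⁺ (All.tabulate dominated)))
    where
    dominated : ∀ {v} → v ∈ l → MaybeAll.All (λ a → Any (a ≤_) (mapMaybe g l)) (f v)
    dominated {v} v∈l = MaybeAll.map witness (f≼g v)
      where
      witness : ∀ {a} → MaybeAny.Any (a ≤_) (g v) → Any (a ≤_) (mapMaybe g l)
      witness a≤gv = Any.mapMaybe⁺ g l (Any.map⁺ (Any.map (λ { refl → a≤gv }) v∈l))

max⁰-map-mono : ∀ {A : Set} (l : List A) {f g : A → ℚ} →
                (∀ v → 0ℚ ≤ g v) → (∀ v → f v ≤ g v) → max⁰ (map f l) ≤ max⁰ (map g l)
max⁰-map-mono l g≥0 f≤g =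
  max⁰-mono (All.map⁺ (All.universal g≥0 l))
            (All.map⁺ (All.tabulate λ v∈l → Any.map⁺ (Any.map (λ { refl → f≤g _ }) v∈l)))

sumℚ-map-mono : ∀ {A : Set} (l : List A) {f g : A → ℚ} →
                (∀ v → f v ≤ g v) → sumℚ (map f l) ≤ sumℚ (map g l)
sumℚ-map-mono []      f≤g = ≤-refl
sumℚ-map-mono (v ∷ l) f≤g = +-mono-≤ (f≤g v) (sumℚ-map-mono l f≤g)

module _ {r : ℚ} (0<r : 0ℚ < r) where
  private instance
    r-positive : Positive r
    r-positive = positive 0<r
    r≢0 : NonZero r
    r≢0 = pos⇒nonZero r
    1/r-nonNeg : NonNegative (1/ r)
    1/r-nonNeg = pos⇒nonNeg (1/ r) {{1/pos⇒pos r}}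

  ÷-monoˡ-≤ : ∀ {p q} → p ≤ q → p ÷ r ≤ q ÷ r
  ÷-monoˡ-≤ = *-monoʳ-≤-nonNeg (1/ r)

  ÷-nonNeg : ∀ {p} → 0ℚ ≤ p → 0ℚ ≤ p ÷ r
  ÷-nonNeg {p} 0≤p = nonNegative⁻¹ _ {{nonNeg*nonNeg⇒nonNeg p {{nonNegative 0≤p}} (1/ r)}}

dist-nonNeg : ∀ {n} (t : Tree n) u v → 0ℚ ≤ dist t u v
dist-nonNeg single             _       _       = ≤-refl
dist-nonNeg (attach t p ℓ 0<ℓ) zero    zero    = ≤-refl
dist-nonNeg (attach t p ℓ 0<ℓ) zero    (suc v) = +-mono-≤ (<⇒≤ 0<ℓ) (dist-nonNeg t p v)
dist-nonNeg (attach t p ℓ 0<ℓ) (suc u) zero    = +-mono-≤ (dist-nonNeg t u p) (<⇒≤ 0<ℓ)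
dist-nonNeg (attach t p ℓ 0<ℓ) (suc u) (suc v) = dist-nonNeg t u v

module _ {n} (t : Tree n) (c : ℚ) (0<c : 0ℚ < c) where

  -- The candidate functions `cand` and `br` are local to ΘBranch and Θ and cannot be named
  -- here, so the types of the candidate lemmas are left to be inferred from their uses.
  candidate-nonNeg : ∀ s Vl x v′ → MaybeAll.All (0ℚ ≤_) _
  branch-nonNeg : ∀ s S x v′ → MaybeAll.All (0ℚ ≤_) _

  ΘBranch-nonNeg : ∀ s Vl x → 0ℚ ≤ ΘBranch t c 0<c s Vl x
  ΘBranch-nonNeg s Vl x = max⁰-mapMaybe-nonNeg (allFin n) (candidate-nonNeg s Vl x)

  Θ-nonNeg : ∀ s S x → 0ℚ ≤ Θ t c 0<c s S x
  Θ-nonNeg s S x = max⁰-mapMaybe-nonNeg (allFin n) (branch-nonNeg s S x)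

  candidate-nonNeg s Vl x v′ with Vl v′ | 0ℚ <? Wgt t s Vl x v′
  ... | false | _       = nothing
  ... | true  | no _    = nothing
  ... | true  | yes 0<W = just (+-mono-≤ (dist-nonNeg t v′ x) (÷-nonNeg 0<c (<⇒≤ 0<W)))

  branch-nonNeg s S x v′ with minus S x v′
  ... | false = nothing
  ... | true  = just (ΘBranch-nonNeg s _ x)

  module _ {s s′ : Scenario n} (s′≤s : ∀ v → s′ v ≤ s v) where

    Wgt-mono : ∀ Vl x v′ → Wgt t s′ Vl x v′ ≤ Wgt t s Vl x v′
    Wgt-mono Vl x v′ = sumℚ-map-mono (allFin n) (λ v → restrict-mono (Dset t Vl x v′ v))
      where
      restrict-mono : ∀ {v} (b : Bool) → (if b then s′ v else 0ℚ) ≤ (if b then s v else 0ℚ)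
      restrict-mono true  = s′≤s _
      restrict-mono false = ≤-refl

    candidate-mono : ∀ Vl x v′ → _ ≼ _
    branch-mono : ∀ S x v′ → _ ≼ _

    ΘBranch-mono : ∀ Vl x → ΘBranch t c 0<c s′ Vl x ≤ ΘBranch t c 0<c s Vl x
    ΘBranch-mono Vl x =
      max⁰-mapMaybe-mono (allFin n) (candidate-nonNeg s Vl x) (candidate-mono Vl x)

    Θ-mono : ∀ S x → Θ t c 0<c s′ S x ≤ Θ t c 0<c s S x
    Θ-mono S x = max⁰-mapMaybe-mono (allFin n) (branch-nonNeg s S x) (branch-mono S x)

    candidate-mono Vl x v′ with Vl v′ | 0ℚ <? Wgt t s′ Vl x v′ | 0ℚ <? Wgt t s Vl x v′
    ... | false | _        | _      = nothing
    ... | true  | no _     | _      = nothing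
    ... | true  | yes 0<W′ | no 0≮W = contradiction (<-≤-trans 0<W′ (Wgt-mono Vl x v′)) 0≮W
    ... | true  | yes _    | yes _  =
      just (just (+-monoʳ-≤ (dist t v′ x) (÷-monoˡ-≤ 0<c (Wgt-mono Vl x v′))))

    branch-mono S x v′ with minus S x v′
    ... | false = nothing
    ... | true  = just (just (ΘBranch-mono _ x))

    ΘPart-mono : ∀ {k} (X : Fin k → Fin n) part → ΘPart t c 0<c s′ X part ≤ ΘPart t c 0<c s X part
    ΘPart-mono {k} X part = max⁰-map-mono (allFin k)
      (λ i → Θ-nonNeg s (Part part i) (X i)) (λ i → Θ-mono (Part part i) (X i))

    ΘOPT-mono : ∀ {k θ θ′} → IsΘOPT t c 0<c k s′ θ′ → IsΘOPT t c 0<c k s θ → θ′ ≤ θ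
    ΘOPT-mono (_ , θ′-minimal) ((X , part , feasible , refl) , _) =
      ≤-trans (θ′-minimal X part feasible) (ΘPart-mono X part)

lemma3 : ∀ {n} (t : Tree n) (c : ℚ) (cpos : 0ℚ < c) (k : ℕ) → k ≥ 1 →
         (s s′ : Scenario n) → IsScenario s → IsScenario s′ →
         (∀ v → s′ v ≤ s v) →
         ((V′ : VSet n) (x : Fin n) → InducesSubtree t V′ → V′ x ≡ true →
            Θ t c cpos s′ V′ x ≤ Θ t c cpos s V′ x) ×
         ((θ θ′ : ℚ) → IsΘOPT t c cpos k s′ θ′ → IsΘOPT t c cpos k s θ →
            θ′ ≤ θ)
lemma3 t c cpos k _ s s′ _ _ s′≤s =
  (λ V′ x _ _ → Θ-mono t c cpos s′≤s V′ x) , (λ θ θ′ → ΘOPT-mono t c cpos s′≤s)
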